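{- Let $G$ be a walk-regular and co-edge-regular graph. If there exists a vertex $x$ of $G$ such that $a_{xy}=a_{xy'}$ for all neighbours $y,y'$ of $x$, then $G$ is strongly regular.
   Context: All graphs are finite, undirected and simple. A co-edge-regular graph with parameters $(n,k,c)$ is a $k$-regular graph on $n$ vertices, neither complete nor edgeless, in which any two distinct non-adjacent vertices have exactly $c$ common neighbours. For adjacent $x,y$, $a_{xy}$ is the number of common neighbours of $x,y$. A graph with adjacency matrix $A$ is walk-regular if for every integer $r\geqslant0$ all diagonal entries of $A^r$ are equal. A strongly regular graph is a $k$-regular graph, neither complete nor edgeless, in which any two adjacent vertices have a constant number $a$ of common neighbours and any two distinct non-adjacent vertices have a constant number $c$ of common neighbours. -}

module Defs where

open import Data.Nat using (ℕ; zero; suc; _+_; _*_)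
open import Data.Fin using (Fin)
open import Data.Bool using (Bool; true; false; if_then_else_)
open import Data.List using (List; map)
open import Data.Nat.ListAction using (sum)
open import Data.List.Base using (allFin)
open import Data.Product using (Σ; ∃; _×_; _,_)
open import Relation.Binary.PropositionalEquality using (_≡_; _≢_)
open import Relation.Nullary using (¬_)
open import Relation.Nullary.Decidable using (⌊_⌋)
open import Data.Fin using (_≟_)

record Graph (n : ℕ) : Set where
  field
    adj   : Fin n → Fin n → Bool
    sym   : ∀ x y → adj x y ≡ adj y x
    irref : ∀ x → adj x x ≡ false
open Graph public

ind : Bool → ℕ
ind true  = 1
ind false = 0

Σv : ∀ {n} → (Fin n → ℕ) → ℕ
Σv {n} f = sum (map f (allFin n))

Adj : ∀ {n} → Graph n → Fin n → Fin n → Set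
Adj G x y = adj G x y ≡ true

deg : ∀ {n} → Graph n → Fin n → ℕ
deg G x = Σv (λ z → ind (adj G x z))

-- number of common neighbours of x and y (this is a_xy for adjacent x,y)
common : ∀ {n} → Graph n → Fin n → Fin n → ℕ
common G x y = Σv (λ z → ind (adj G x z) * ind (adj G z y))

-- (A^r)_{xy}: number of walks of length r from x to y
walks : ∀ {n} → Graph n → ℕ → Fin n → Fin n → ℕ
walks G zero    x y = ind ⌊ x ≟ y ⌋
walks G (suc r) x y = Σv (λ z → ind (adj G x z) * walks G r z y)

Regular : ∀ {n} → Graph n → ℕ → Set
Regular G k = ∀ x → deg G x ≡ k

NotComplete : ∀ {n} → Graph n → Set
NotComplete G = ∃ λ x → ∃ λ y → x ≢ y × adj G x y ≡ false

NotEdgeless : ∀ {n} → Graph n → Set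
NotEdgeless G = ∃ λ x → ∃ λ y → Adj G x y

-- co-edge-regular with parameters (n,k,c) (n is the vertex count, built in)
CoEdgeRegular : ∀ {n} → Graph n → ℕ → ℕ → Set
CoEdgeRegular G k c =
  Regular G k × NotComplete G × NotEdgeless G ×
  (∀ x y → x ≢ y → adj G x y ≡ false → common G x y ≡ c)

WalkRegular : ∀ {n} → Graph n → Set
WalkRegular G = ∀ r x y → walks G r x x ≡ walks G r y y

StronglyRegularWith : ∀ {n} → Graph n → ℕ → ℕ → ℕ → Set
StronglyRegularWith G k a c =
  Regular G k × NotComplete G × NotEdgeless G ×
  (∀ x y → Adj G x y → common G x y ≡ a) ×
  (∀ x y → x ≢ y → adj G x y ≡ false → common G x y ≡ c)

StronglyRegular : ∀ {n} → Graph n → Set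
StronglyRegular G = ∃ λ k → ∃ λ a → ∃ λ c → StronglyRegularWith G k a c

-- For adjacent x, w write a(x,w) for their number of common neighbours. The
-- diagonal entries of A³ and A⁴ are Σ_{w~x} a(x,w) and
-- k² + Σ_{w~x} a(x,w)² + (n − 1 − k) c², so walk-regularity makes the first
-- two moments of a(x,·) over the neighbourhood of x independent of x. At the
-- distinguished vertex they are k a and k a², hence at every vertex
-- Σ_{w~x} (a(x,w) − a)² = 0, i.e. every edge lies in exactly a triangles.
module Submission where

open import Defs hiding (sym)
open import Data.Nat.Properties hiding (_≟_)
open import Algebra.Properties.Semiring.Sum +-*-semiring
  using (sum; sum-cong-≗; ∑-distrib-+; ∑-comm; *-distribˡ-sum; *-distribʳ-sum;
         sum-remove; sum-replicate-zero)
open import Data.Bool using (Bool; true; false; not; _∧_)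
open import Data.Fin using (Fin; zero; suc; _≟_; punchIn)
open import Data.Fin.Properties using (punchInᵢ≢i)
open import Data.List.Base using (tabulate)
open import Data.List.Properties using (map-tabulate)
import Data.Nat.ListAction as List
open import Data.Nat using (ℕ; zero; suc; _+_; _*_; _≤_; z≤n; ∣_-_∣; ≢-nonZero)
open import Data.Nat.Solver using (module +-*-Solver)
open import Data.Product using (∃; _,_; proj₁; proj₂)
open import Data.Sum using ([_,_]′)
open import Function using (_∘_; id)
open import Relation.Binary.PropositionalEquality
  using (_≡_; _≢_; refl; sym; trans; subst; cong; cong₂; module ≡-Reasoning)
open import Relation.Nullary using (yes; no)
open import Relation.Nullary.Decidable using (⌊_⌋; isYes≗does; dec-true; dec-false)

open +-*-Solver using (solve; _:+_; _:*_; _:=_; con)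

sum-tabulate : ∀ {n} (f : Fin n → ℕ) → List.sum (tabulate f) ≡ sum f
sum-tabulate {zero}  f = refl
sum-tabulate {suc n} f = cong (f zero +_) (sum-tabulate (f ∘ suc))

Σv≡sum : ∀ {n} (f : Fin n → ℕ) → Σv f ≡ sum f
Σv≡sum f = trans (cong List.sum (map-tabulate id f)) (sum-tabulate f)

sum-*ˡ : ∀ {n} a (f : Fin n → ℕ) → sum (λ i → a * f i) ≡ a * sum f
sum-*ˡ a f = sym (*-distribˡ-sum a f)

sum-*ʳ : ∀ {n} a (f : Fin n → ℕ) → sum (λ i → f i * a) ≡ sum f * a
sum-*ʳ a f = sym (*-distribʳ-sum a f)

sum-ones : ∀ n → sum (λ (_ : Fin n) → 1) ≡ n
sum-ones zero    = refl
sum-ones (suc n) = cong suc (sum-ones n)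

sum-supported-at : ∀ {n} (f : Fin n → ℕ) x → (∀ w → w ≢ x → f w ≡ 0) → sum f ≡ f x
sum-supported-at {suc n} f x vanishes = begin
  sum f                      ≡⟨ sum-remove {i = x} f ⟩
  f x + sum (f ∘ punchIn x)  ≡⟨ cong (f x +_) rest≡0 ⟩
  f x + 0                    ≡⟨ +-identityʳ (f x) ⟩
  f x                        ∎
  where
  open ≡-Reasoning
  rest≡0 : sum (f ∘ punchIn x) ≡ 0
  rest≡0 = trans (sum-cong-≗ (λ j → vanishes _ (punchInᵢ≢i x j))) (sum-replicate-zero n)

term≤sum : ∀ {n} (f : Fin n → ℕ) i → f i ≤ sum f
term≤sum {suc n} f i = ≤-trans (m≤m+n (f i) _) (≤-reflexive (sym (sum-remove {i = i} f)))

sum-mono : ∀ {n} {f g : Fin n → ℕ} → (∀ i → f i ≤ g i) → sum f ≤ sum g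
sum-mono {zero}  f≤g = z≤n
sum-mono {suc n} f≤g = +-mono-≤ (f≤g zero) (sum-mono (f≤g ∘ suc))

sum-mono-tight : ∀ {n} {f g : Fin n → ℕ} → (∀ i → f i ≤ g i) → sum g ≡ sum f →
                 ∀ i → f i ≡ g i
sum-mono-tight {suc n} {f} {g} f≤g sums i = ≤-antisym (f≤g i) gᵢ≤fᵢ
  where
  open ≤-Reasoning
  gᵢ≤fᵢ : g i ≤ f i
  gᵢ≤fᵢ = +-cancelʳ-≤ (sum (f ∘ punchIn i)) (g i) (f i) (begin
    g i + sum (f ∘ punchIn i)  ≤⟨ +-monoʳ-≤ (g i) (sum-mono (f≤g ∘ punchIn i)) ⟩
    g i + sum (g ∘ punchIn i)  ≡⟨ sum-remove {i = i} g ⟨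
    sum g                      ≡⟨ sums ⟩
    sum f                      ≡⟨ sum-remove {i = i} f ⟩
    f i + sum (f ∘ punchIn i)  ∎)

sum-ind-pos : ∀ {n} (b : Fin n → Bool) → 1 ≤ sum (ind ∘ b) → ∃ λ i → b i ≡ true
sum-ind-pos {suc n} b pos with b zero in b₀
... | true  = zero , b₀
... | false with sum-ind-pos (b ∘ suc) pos
...   | i , bᵢ = suc i , bᵢ

sum-δ : ∀ {n} (f : Fin n → ℕ) y → sum (λ w → f w * ind ⌊ w ≟ y ⌋) ≡ f y
sum-δ f y = trans (sum-supported-at _ y off-y) (trans (cong (λ b → f y * ind b) (trans (isYes≗does (y ≟ y)) (dec-true (y ≟ y) refl)))
                                                      (*-identityʳ (f y)))
  where
  off-y : ∀ w → w ≢ y → f w * ind ⌊ w ≟ y ⌋ ≡ 0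
  off-y w w≢y = trans (cong (λ b → f w * ind b) (trans (isYes≗does (w ≟ y)) (dec-false (w ≟ y) w≢y))) (*-zeroʳ (f w))

ind-idem : ∀ b → ind b * ind b ≡ ind b
ind-idem true  = refl
ind-idem false = refl

ind-*-cong : ∀ b {s t} → (b ≡ true → s ≡ t) → ind b * s ≡ ind b * t
ind-*-cong true  s≡t = cong (1 *_) (s≡t refl)
ind-*-cong false s≡t = refl

m²+n²≡2mn+∣m-n∣² : ∀ m n → m * m + n * n ≡ 2 * (m * n) + ∣ m - n ∣ * ∣ m - n ∣
m²+n²≡2mn+∣m-n∣² m n = [ gap , gap-flipped ]′ (≤-total m n)
  where
  gap : ∀ {m n} → m ≤ n → m * m + n * n ≡ 2 * (m * n) + ∣ m - n ∣ * ∣ m - n ∣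
  gap {m} m≤n with m≤n⇒∃[o]m+o≡n m≤n
  ... | d , refl rewrite ∣m-m+n∣≡n m d =
    solve 2 (λ m d → m :* m :+ (m :+ d) :* (m :+ d)
                   := con 2 :* (m :* (m :+ d)) :+ d :* d) refl m d
  gap-flipped : n ≤ m → m * m + n * n ≡ 2 * (m * n) + ∣ m - n ∣ * ∣ m - n ∣
  gap-flipped n≤m = begin
    m * m + n * n                        ≡⟨ +-comm (m * m) (n * n) ⟩
    n * n + m * m                        ≡⟨ gap n≤m ⟩
    2 * (n * m) + ∣ n - m ∣ * ∣ n - m ∣  ≡⟨ cong₂ (λ p q → 2 * p + q * q) (*-comm n m) (∣-∣-comm n m) ⟩
    2 * (m * n) + ∣ m - n ∣ * ∣ m - n ∣  ∎
    where open ≡-Reasoning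

2mn≤m²+n² : ∀ m n → 2 * (m * n) ≤ m * m + n * n
2mn≤m²+n² m n = ≤-trans (m≤m+n _ _) (≤-reflexive (sym (m²+n²≡2mn+∣m-n∣² m n)))

m²+n²≡2mn⇒m≡n : ∀ m n → m * m + n * n ≡ 2 * (m * n) → m ≡ n
m²+n²≡2mn⇒m≡n m n eq = ∣m-n∣≡0⇒m≡n ([ id , id ]′ (m*n≡0⇒m≡0∨n≡0 ∣ m - n ∣ gap²≡0))
  where
  gap²≡0 : ∣ m - n ∣ * ∣ m - n ∣ ≡ 0
  gap²≡0 = +-cancelˡ-≡ (2 * (m * n)) _ _
    (trans (sym (m²+n²≡2mn+∣m-n∣² m n)) (trans eq (sym (+-identityʳ _))))

-- The weighted variance Σ m (f − a)² vanishes; avoiding subtraction, this says the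
-- pointwise inequality m (2fa) ≤ m (f² + a²) has equal sums, so it is tight.
equal-moments⇒constant : ∀ {n} (m f : Fin n → ℕ) a →
  sum (λ i → m i * f i) ≡ sum m * a →
  sum (λ i → m i * (f i * f i)) ≡ sum m * (a * a) →
  ∀ i → m i ≢ 0 → f i ≡ a
equal-moments⇒constant m f a first second i mᵢ≢0 =
  m²+n²≡2mn⇒m≡n (f i) a
    (*-cancelˡ-≡ _ _ (m i) {{≢-nonZero mᵢ≢0}} (sym (sum-mono-tight cross≤squares sums i)))
  where
  cross≤squares : ∀ j → m j * (2 * (f j * a)) ≤ m j * (f j * f j + a * a)
  cross≤squares j = *-monoʳ-≤ (m j) (2mn≤m²+n² (f j) a)
  open ≡-Reasoning
  sums : sum (λ j → m j * (f j * f j + a * a)) ≡ sum (λ j → m j * (2 * (f j * a)))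
  sums = begin
    sum (λ j → m j * (f j * f j + a * a))
      ≡⟨ sum-cong-≗ (λ j → *-distribˡ-+ (m j) _ _) ⟩
    sum (λ j → m j * (f j * f j) + m j * (a * a))
      ≡⟨ ∑-distrib-+ (λ j → m j * (f j * f j)) (λ j → m j * (a * a)) ⟩
    sum (λ j → m j * (f j * f j)) + sum (λ j → m j * (a * a))
      ≡⟨ cong₂ _+_ second (sum-*ʳ (a * a) m) ⟩
    sum m * (a * a) + sum m * (a * a)
      ≡⟨ solve 2 (λ s a → s :* (a :* a) :+ s :* (a :* a) := con 2 :* a :* (s :* a)) refl (sum m) a ⟩
    2 * a * (sum m * a)
      ≡⟨ cong (2 * a *_) first ⟨
    2 * a * sum (λ j → m j * f j)
      ≡⟨ sum-*ˡ (2 * a) (λ j → m j * f j) ⟨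
    sum (λ j → 2 * a * (m j * f j))
      ≡⟨ sum-cong-≗ (λ j → solve 3 (λ a m f → con 2 :* a :* (m :* f) := m :* (con 2 :* (f :* a))) refl a (m j) (f j)) ⟩
    sum (λ j → m j * (2 * (f j * a)))
      ∎

module _ {n} (G : Graph n) where

  A : Fin n → Fin n → ℕ
  A x y = ind (adj G x y)

  A-sym : ∀ x y → A x y ≡ A y x
  A-sym x y = cong ind (Graph.sym G x y)

  deg≡sum : ∀ x → deg G x ≡ sum (A x)
  deg≡sum x = Σv≡sum (A x)

  common≡sum : ∀ x y → common G x y ≡ sum (λ z → A x z * A z y)
  common≡sum x y = Σv≡sum (λ z → A x z * A z y)

  common-sym : ∀ x y → common G x y ≡ common G y x
  common-sym x y = begin
    common G x y               ≡⟨ common≡sum x y ⟩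
    sum (λ z → A x z * A z y)  ≡⟨ sum-cong-≗ (λ z → trans (*-comm (A x z) (A z y))
                                                          (cong₂ _*_ (A-sym z y) (A-sym x z))) ⟩
    sum (λ z → A y z * A z x)  ≡⟨ common≡sum y x ⟨
    common G y x               ∎
    where open ≡-Reasoning

  common-self : ∀ x → common G x x ≡ deg G x
  common-self x = begin
    common G x x               ≡⟨ common≡sum x x ⟩
    sum (λ z → A x z * A z x)  ≡⟨ sum-cong-≗ (λ z → trans (cong (A x z *_) (A-sym z x)) (ind-idem (adj G x z))) ⟩
    sum (A x)                  ≡⟨ deg≡sum x ⟨
    deg G x                    ∎
    where open ≡-Reasoning

  Adj⇒1≤deg : ∀ {x y} → Adj G x y → 1 ≤ deg G x
  Adj⇒1≤deg {x} {y} xy = begin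
    1          ≡⟨ cong ind xy ⟨
    A x y      ≤⟨ term≤sum (A x) y ⟩
    sum (A x)  ≡⟨ deg≡sum x ⟨
    deg G x    ∎
    where open ≤-Reasoning

  1≤deg⇒neighbour : ∀ x → 1 ≤ deg G x → ∃ (Adj G x)
  1≤deg⇒neighbour x pos = sum-ind-pos (adj G x) (≤-trans pos (≤-reflexive (deg≡sum x)))

  Adj⇒A≢0 : ∀ {x y} → Adj G x y → A x y ≢ 0
  Adj⇒A≢0 xy A≡0 = 1+n≢0 (trans (sym (cong ind xy)) A≡0)

  sum-neighbours-const : ∀ x (f : Fin n → ℕ) a → (∀ w → Adj G x w → f w ≡ a) →
                         sum (λ w → A x w * f w) ≡ sum (A x) * a
  sum-neighbours-const x f a f≡a =
    trans (sum-cong-≗ (λ w → ind-*-cong (adj G x w) (f≡a w))) (sum-*ʳ a (A x))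

  walks-1 : ∀ x y → walks G 1 x y ≡ A x y
  walks-1 x y = trans (Σv≡sum (λ w → A x w * walks G 0 w y)) (sum-δ (A x) y)

  walks-2+ : ∀ r x y → walks G (2 + r) x y ≡ sum (λ w → common G x w * walks G r w y)
  walks-2+ r x y = begin
    walks G (2 + r) x y
      ≡⟨ Σv≡sum (λ z → A x z * walks G (1 + r) z y) ⟩
    sum (λ z → A x z * walks G (1 + r) z y)
      ≡⟨ sum-cong-≗ (λ z → cong (A x z *_) (Σv≡sum (λ w → A z w * W w))) ⟩
    sum (λ z → A x z * sum (λ w → A z w * W w))
      ≡⟨ sum-cong-≗ (λ z → sum-*ˡ (A x z) (λ w → A z w * W w)) ⟨
    sum (λ z → sum (λ w → A x z * (A z w * W w)))
      ≡⟨ ∑-comm (λ z w → A x z * (A z w * W w)) ⟩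
    sum (λ w → sum (λ z → A x z * (A z w * W w)))
      ≡⟨ sum-cong-≗ (λ w → trans (sum-cong-≗ (λ z → sym (*-assoc (A x z) (A z w) (W w))))
                                  (sum-*ʳ (W w) (λ z → A x z * A z w))) ⟩
    sum (λ w → sum (λ z → A x z * A z w) * W w)
      ≡⟨ sum-cong-≗ (λ w → cong (_* W w) (common≡sum x w)) ⟨
    sum (λ w → common G x w * W w)
      ∎
    where
    open ≡-Reasoning
    W : Fin n → ℕ
    W w = walks G r w y

  walks-2 : ∀ x y → walks G 2 x y ≡ common G x y
  walks-2 x y = trans (walks-2+ 0 x y) (sum-δ (common G x) y)

  Σa Σa² : Fin n → ℕ
  Σa  x = sum (λ w → A x w * common G x w)
  Σa² x = sum (λ w → A x w * (common G x w * common G x w))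

  walks-3-diag : ∀ x → walks G 3 x x ≡ Σa x
  walks-3-diag x = trans (walks-2+ 1 x x) (sum-cong-≗ λ w →
    trans (cong (common G x w *_) (trans (walks-1 w x) (A-sym w x))) (*-comm (common G x w) (A x w)))

  walks-4-diag : ∀ x → walks G 4 x x ≡ sum (λ w → common G x w * common G x w)
  walks-4-diag x = trans (walks-2+ 2 x x) (sum-cong-≗ λ w →
    cong (common G x w *_) (trans (walks-2 w x) (common-sym w x)))

  distinctNonAdj : Fin n → Fin n → Bool
  distinctNonAdj x w = not ⌊ w ≟ x ⌋ ∧ not (adj G x w)

  unit-partition : ∀ x w → ind ⌊ w ≟ x ⌋ + A x w + ind (distinctNonAdj x w) ≡ 1
  unit-partition x w with w ≟ x
  ... | yes refl rewrite irref G w = refl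
  ... | no _ with adj G x w
  ...   | true  = refl
  ...   | false = refl

  sum-split-at : ∀ x (h : Fin n → ℕ) →
    sum h ≡ h x + sum (λ w → A x w * h w) + sum (λ w → ind (distinctNonAdj x w) * h w)
  sum-split-at x h = begin
    sum h
      ≡⟨ sum-cong-≗ expand ⟩
    sum (λ w → h w * δ w + A x w * h w + N w * h w)
      ≡⟨ ∑-distrib-+ (λ w → h w * δ w + A x w * h w) (λ w → N w * h w) ⟩
    sum (λ w → h w * δ w + A x w * h w) + sum (λ w → N w * h w)
      ≡⟨ cong (_+ sum (λ w → N w * h w)) (∑-distrib-+ (λ w → h w * δ w) (λ w → A x w * h w)) ⟩
    sum (λ w → h w * δ w) + sum (λ w → A x w * h w) + sum (λ w → N w * h w)
      ≡⟨ cong (λ s → s + sum (λ w → A x w * h w) + sum (λ w → N w * h w)) (sum-δ h x) ⟩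
    h x + sum (λ w → A x w * h w) + sum (λ w → N w * h w)
      ∎
    where
    open ≡-Reasoning
    δ N : Fin n → ℕ
    δ w = ind ⌊ w ≟ x ⌋
    N w = ind (distinctNonAdj x w)
    expand : ∀ w → h w ≡ h w * δ w + A x w * h w + N w * h w
    expand w = begin
      h w                         ≡⟨ *-identityʳ (h w) ⟨
      h w * 1                     ≡⟨ cong (h w *_) (unit-partition x w) ⟨
      h w * (δ w + A x w + N w)   ≡⟨ solve 4 (λ h d a m → h :* (d :+ a :+ m) := h :* d :+ a :* h :+ m :* h)
                                           refl (h w) (δ w) (A x w) (N w) ⟩
      h w * δ w + A x w * h w + N w * h w ∎

module _ {n} {G : Graph n} {k c : ℕ} (regular : Regular G k)
         (nonAdjacent-common : ∀ x y → x ≢ y → adj G x y ≡ false → common G x y ≡ c) where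

  degree-sum-const : ∀ x y → sum (A G x) ≡ sum (A G y)
  degree-sum-const x y = trans (sym (deg≡sum G x)) (trans (trans (regular x) (sym (regular y))) (deg≡sum G y))

  nonneighbours : Fin n → ℕ
  nonneighbours x = sum (λ w → ind (distinctNonAdj G x w))

  distinctNonAdj⇒common≡c : ∀ x w → distinctNonAdj G x w ≡ true → common G x w ≡ c
  distinctNonAdj⇒common≡c x w sep with w ≟ x | adj G x w in x≁w
  distinctNonAdj⇒common≡c x w () | yes _   | _
  distinctNonAdj⇒common≡c x w () | no _    | true
  distinctNonAdj⇒common≡c x w _  | no w≢x  | false = nonAdjacent-common x w (w≢x ∘ sym) x≁w

  vertex-count : ∀ x → n ≡ 1 + k + nonneighbours x
  vertex-count x = begin
    n
      ≡⟨ sum-ones n ⟨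
    sum (λ (_ : Fin n) → 1)
      ≡⟨ sum-split-at G x (λ _ → 1) ⟩
    1 + sum (λ w → A G x w * 1) + sum (λ w → ind (distinctNonAdj G x w) * 1)
      ≡⟨ cong₂ (λ s t → 1 + s + t) (sum-cong-≗ (λ w → *-identityʳ (A G x w)))
                                   (sum-cong-≗ (λ w → *-identityʳ (ind (distinctNonAdj G x w)))) ⟩
    1 + sum (A G x) + nonneighbours x
      ≡⟨ cong (λ d → 1 + d + nonneighbours x) (trans (sym (deg≡sum G x)) (regular x)) ⟩
    1 + k + nonneighbours x
      ∎
    where open ≡-Reasoning

  walks-4-diag-split : ∀ x → walks G 4 x x ≡ k * k + Σa² G x + nonneighbours x * (c * c)
  walks-4-diag-split x = begin
    walks G 4 x x
      ≡⟨ walks-4-diag G x ⟩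
    sum (λ w → a w * a w)
      ≡⟨ sum-split-at G x (λ w → a w * a w) ⟩
    a x * a x + Σa² G x + sum (λ w → ind (distinctNonAdj G x w) * (a w * a w))
      ≡⟨ cong₂ (λ s t → s + Σa² G x + t) (cong (λ d → d * d) (trans (common-self G x) (regular x)))
                                        (sum-cong-≗ (λ w → ind-*-cong (distinctNonAdj G x w)
                                          (cong (λ d → d * d) ∘ distinctNonAdj⇒common≡c x w))) ⟩
    k * k + Σa² G x + sum (λ w → ind (distinctNonAdj G x w) * (c * c))
      ≡⟨ cong (k * k + Σa² G x +_) (sum-*ʳ (c * c) (λ w → ind (distinctNonAdj G x w))) ⟩
    k * k + Σa² G x + nonneighbours x * (c * c)
      ∎
    where
    open ≡-Reasoning
    a : Fin n → ℕ
    a = common G x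

  module _ (walkRegular : WalkRegular G) where

    Σa-const : ∀ x y → Σa G x ≡ Σa G y
    Σa-const x y = trans (sym (walks-3-diag G x)) (trans (walkRegular 3 x y) (walks-3-diag G y))

    Σa²-const : ∀ x y → Σa² G x ≡ Σa² G y
    Σa²-const x y = +-cancelˡ-≡ (k * k) _ _ (+-cancelʳ-≡ (nonneighbours x * (c * c)) _ _ (begin
      k * k + Σa² G x + nonneighbours x * (c * c)  ≡⟨ walks-4-diag-split x ⟨
      walks G 4 x x                                ≡⟨ walkRegular 4 x y ⟩
      walks G 4 y y                                ≡⟨ walks-4-diag-split y ⟩
      k * k + Σa² G y + nonneighbours y * (c * c)  ≡⟨ cong (λ m → k * k + Σa² G y + m * (c * c)) N-const ⟨
      k * k + Σa² G y + nonneighbours x * (c * c)  ∎))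
      where
      open ≡-Reasoning
      N-const : nonneighbours x ≡ nonneighbours y
      N-const = +-cancelˡ-≡ (1 + k) _ _ (trans (sym (vertex-count x)) (vertex-count y))

    first-moment : ∀ x₀ a → (∀ w → Adj G x₀ w → common G x₀ w ≡ a) →
                   ∀ x → Σa G x ≡ sum (A G x) * a
    first-moment x₀ a uniform x = begin
      Σa G x            ≡⟨ Σa-const x x₀ ⟩
      Σa G x₀           ≡⟨ sum-neighbours-const G x₀ (common G x₀) a uniform ⟩
      sum (A G x₀) * a  ≡⟨ cong (_* a) (degree-sum-const x₀ x) ⟩
      sum (A G x) * a   ∎
      where open ≡-Reasoning

    second-moment : ∀ x₀ a → (∀ w → Adj G x₀ w → common G x₀ w ≡ a) →
                    ∀ x → Σa² G x ≡ sum (A G x) * (a * a)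
    second-moment x₀ a uniform x = begin
      Σa² G x                 ≡⟨ Σa²-const x x₀ ⟩
      Σa² G x₀                ≡⟨ sum-neighbours-const G x₀ (λ w → common G x₀ w * common G x₀ w) (a * a)
                                   (λ w → cong (λ d → d * d) ∘ uniform w) ⟩
      sum (A G x₀) * (a * a)  ≡⟨ cong (_* (a * a)) (degree-sum-const x₀ x) ⟩
      sum (A G x) * (a * a)   ∎
      where open ≡-Reasoning

lemma3p2 : ∀ {n} (G : Graph n) (k c : ℕ) →
    WalkRegular G → CoEdgeRegular G k c →
    (∃ λ (x : Fin n) → ∀ y y' → Adj G x y → Adj G x y' →
       common G x y ≡ common G x y') →
    StronglyRegular G
lemma3p2 G k c walkRegular (regular , notComplete , (u , v , u~v) , nonAdjacent-common) (x₀ , uniform) =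
  k , a , c , regular , notComplete , (u , v , u~v) , edge-common , nonAdjacent-common
  where
  x₀-neighbour : ∃ (Adj G x₀)
  x₀-neighbour = 1≤deg⇒neighbour G x₀ (subst (1 ≤_) (trans (regular u) (sym (regular x₀))) (Adj⇒1≤deg G u~v))

  a : ℕ
  a = common G x₀ (proj₁ x₀-neighbour)

  a-at-x₀ : ∀ w → Adj G x₀ w → common G x₀ w ≡ a
  a-at-x₀ w x₀~w = uniform w (proj₁ x₀-neighbour) x₀~w (proj₂ x₀-neighbour)

  edge-common : ∀ x w → Adj G x w → common G x w ≡ a
  edge-common x w x~w = equal-moments⇒constant (A G x) (common G x) a
    (first-moment regular nonAdjacent-common walkRegular x₀ a a-at-x₀ x)
    (second-moment regular nonAdjacent-common walkRegular x₀ a a-at-x₀ x)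
    w (Adj⇒A≢0 G x~w)
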